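{- For every connected graph $G$, $|V(G)|\le \mathsf{s}(G)+\mathsf{s}(G)^2\cdot\Delta(G)$.
   Context: $\Delta(G)$ is the maximum degree of $G$. A non-empty set $S\subseteq V(G)$ is a safe set if no connected component $C$ of $G[S]$ is adjacent (joined by an edge) to a connected component $D$ of $G-S$ with $|C|<|D|$; $\mathsf{s}(G)$ is the minimum size of a safe set of $G$. -}

module Defs where

open import Data.Nat using (ℕ; zero; suc; _+_; _*_; _≤_; _⊔_)
open import Data.Bool using (Bool; true; false; T)
open import Data.Fin using (Fin)
open import Data.Fin.Subset using (Subset; _∈_; _∉_; _⊆_; ∣_∣; ∁; Nonempty)
open import Data.Vec using (tabulate)
open import Data.List using (List; foldr; map; allFin)
open import Data.Product using (Σ; _×_; ∃; ∃-syntax)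
open import Relation.Binary.PropositionalEquality using (_≡_)

record Graph : Set where
  field
    n     : ℕ
    adj   : Fin n → Fin n → Bool
    sym   : ∀ u v → adj u v ≡ adj v u
    irrefl : ∀ v → adj v v ≡ false
open Graph public

Adj : (G : Graph) → Fin (n G) → Fin (n G) → Set
Adj G u v = T (adj G u v)

data PathIn (G : Graph) (P : Subset (n G)) : Fin (n G) → Fin (n G) → Set where
  here : ∀ {u} → u ∈ P → PathIn G P u u
  step : ∀ {u w v} → u ∈ P → Adj G u w → PathIn G P w v → PathIn G P u v

V : (G : Graph) → Subset (n G)
V G = tabulate (λ _ → true)

Connected : Graph → Set
Connected G = Nonempty (V G) × (∀ u v → PathIn G (V G) u v)

IsComponent : (G : Graph) → Subset (n G) → Subset (n G) → Set
IsComponent G S C =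
  Nonempty C × C ⊆ S
  × (∀ u v → u ∈ C → v ∈ C → PathIn G C u v)
  × (∀ u v → u ∈ C → v ∈ S → Adj G u v → v ∈ C)

Joined : (G : Graph) → Subset (n G) → Subset (n G) → Set
Joined G C D = ∃[ u ] ∃[ v ] (u ∈ C × v ∈ D × Adj G u v)

SafeSet : (G : Graph) → Subset (n G) → Set
SafeSet G S =
  Nonempty S ×
  (∀ C D → IsComponent G S C → IsComponent G (∁ S) D → Joined G C D → ∣ D ∣ ≤ ∣ C ∣)

MinimumSafeSet : (G : Graph) → Subset (n G) → Set
MinimumSafeSet G S = SafeSet G S × (∀ T → SafeSet G T → ∣ S ∣ ≤ ∣ T ∣)

SafeNumber : Graph → ℕ → Set
SafeNumber G k = Σ (Subset (n G)) (λ S → MinimumSafeSet G S × ∣ S ∣ ≡ k)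

degree : (G : Graph) → Fin (n G) → ℕ
degree G v = ∣ tabulate (adj G v) ∣

-- Maximum degree Δ(G) (0 for the empty graph).
Δ : Graph → ℕ
Δ G = foldr _⊔_ 0 (map (degree G) (allFin (n G)))

-- Let S be any safe set of the connected graph G. Every component D of G − S is joined to S by
-- an edge, hence to some component C of G[S], and safety gives ∣D∣ ≤ ∣C∣ ≤ ∣S∣. Moreover D meets
-- the neighbourhood N(S), which has at most ∣S∣·Δ(G) vertices, so the components of G − S are
-- covered by at most ∣S∣·Δ(G) sets of size at most ∣S∣.
module Submission where

open import Defs
open import Data.Nat using (ℕ; zero; suc; _+_; _*_; _≤_; _<_; _⊔_; z≤n; s≤s)
open import Data.Nat.Properties
  using (≤-refl; ≤-trans; ≤-reflexive; +-monoʳ-≤; +-monoˡ-≤; +-mono-≤; *-monoˡ-≤; n≤1+n; +-suc;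
         +-identityʳ; <⇒≱; m≤m⊔n; m≤n⊔m; m+[n∸m]≡n; *-commutativeSemigroup; module ≤-Reasoning)
open import Algebra.Properties.CommutativeSemigroup *-commutativeSemigroup using (xy∙z≈xz∙y)
open import Data.Bool using (Bool; true; false; T)
open import Data.Bool.Properties using (T-≡)
open import Data.Fin using (Fin; zero; suc)
open import Data.Fin.Properties using (any?)
open import Data.Fin.Subset using (Subset; _∈_; _∉_; _⊆_; ∣_∣; ∁; Nonempty; _∪_; ⁅_⁆; ⊥)
open import Data.Fin.Subset.Properties
  using (_∈?_; ∣⊥∣≡0; ∣p∣≤n; ∣⁅x⁆∣≡1; x∈⁅x⁆; x∈⁅y⁆⇒x≡y; p⊆p∪q; q⊆p∪q; x∈p∪q⁺; x∈p∪q⁻;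
         p⊆q⇒∣p∣≤∣q∣; p⊂q⇒∣p∣<∣q∣; x∈p⇒x∉∁p; x∉∁p⇒x∈p; ∣∁p∣≡n∸∣p∣)
open import Data.Vec using ([]; _∷_; here; there; tabulate)
open import Data.Vec.Properties using (lookup∘tabulate; lookup⇒[]=)
open import Data.List using (List; _∷_; foldr)
open import Data.List.Membership.Propositional using () renaming (_∈_ to _∈ˡ_)
open import Data.List.Membership.Propositional.Properties using (∈-map⁺; ∈-allFin)
open import Data.List.Relation.Unary.Any using (here; there)
open import Data.Product using (_×_; _,_; proj₁; ∃; ∃₂)
open import Data.Sum using (inj₁; inj₂)
open import Function using (_∘_; Equivalence)
open import Relation.Binary.PropositionalEquality using (_≡_; refl; trans; cong; subst) renaming (sym to ≡-sym)
open import Relation.Nullary using (Dec; yes; no; ¬?; _×-dec_; contradiction)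
open import Relation.Nullary.Decidable using (T?)
open import Relation.Unary using (Decidable)

private
  variable
    m k : ℕ

∣p∪q∣≤∣p∣+∣q∣ : (p q : Subset k) → ∣ p ∪ q ∣ ≤ ∣ p ∣ + ∣ q ∣
∣p∪q∣≤∣p∣+∣q∣ []          []          = z≤n
∣p∪q∣≤∣p∣+∣q∣ (true ∷ p)  (true ∷ q)  = s≤s (≤-trans (∣p∪q∣≤∣p∣+∣q∣ p q) (+-monoʳ-≤ ∣ p ∣ (n≤1+n _)))
∣p∪q∣≤∣p∣+∣q∣ (true ∷ p)  (false ∷ q) = s≤s (∣p∪q∣≤∣p∣+∣q∣ p q)
∣p∪q∣≤∣p∣+∣q∣ (false ∷ p) (true ∷ q)  = subst (suc ∣ p ∪ q ∣ ≤_) (≡-sym (+-suc ∣ p ∣ ∣ q ∣)) (s≤s (∣p∪q∣≤∣p∣+∣q∣ p q))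
∣p∪q∣≤∣p∣+∣q∣ (false ∷ p) (false ∷ q) = ∣p∪q∣≤∣p∣+∣q∣ p q

bigUnion : Subset m → (Fin m → Subset k) → Subset k
bigUnion []          A = ⊥
bigUnion (true ∷ I)  A = A zero ∪ bigUnion I (A ∘ suc)
bigUnion (false ∷ I) A = bigUnion I (A ∘ suc)

syntax bigUnion I (λ i → A) = ⋃[ i ∈ I ] A

x∈⋃⁺ : ∀ (I : Subset m) (A : Fin m → Subset k) {i x} → i ∈ I → x ∈ A i → x ∈ bigUnion I A
x∈⋃⁺ (true ∷ I)  A here       x∈A = x∈p∪q⁺ (inj₁ x∈A)
x∈⋃⁺ (true ∷ I)  A (there i∈I) x∈A = x∈p∪q⁺ {p = A zero} (inj₂ (x∈⋃⁺ I (A ∘ suc) i∈I x∈A))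
x∈⋃⁺ (false ∷ I) A (there i∈I) x∈A = x∈⋃⁺ I (A ∘ suc) i∈I x∈A

∣⋃∣≤∣I∣*c : ∀ (I : Subset m) (A : Fin m → Subset k) c →
            (∀ {i} → i ∈ I → ∣ A i ∣ ≤ c) → ∣ bigUnion I A ∣ ≤ ∣ I ∣ * c
∣⋃∣≤∣I∣*c {k = k} [] A c _ = ≤-reflexive (∣⊥∣≡0 k)
∣⋃∣≤∣I∣*c (true ∷ I)  A c bound = ≤-trans (∣p∪q∣≤∣p∣+∣q∣ (A zero) (bigUnion I (A ∘ suc)))
  (+-mono-≤ (bound here) (∣⋃∣≤∣I∣*c I (A ∘ suc) c (bound ∘ there)))
∣⋃∣≤∣I∣*c (false ∷ I) A c bound = ∣⋃∣≤∣I∣*c I (A ∘ suc) c (bound ∘ there)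

x∈tabulate⁺ : ∀ {f : Fin k → Bool} {x} → T (f x) → x ∈ tabulate f
x∈tabulate⁺ {f = f} {x} fx = lookup⇒[]= x _ (trans (lookup∘tabulate f x) (Equivalence.to T-≡ fx))

∣p∣+∣∁p∣≡n : (p : Subset k) → ∣ p ∣ + ∣ ∁ p ∣ ≡ k
∣p∣+∣∁p∣≡n p = trans (cong (∣ p ∣ +_) (∣∁p∣≡n∸∣p∣ p)) (m+[n∸m]≡n (∣p∣≤n p))

x≤foldr-⊔ : ∀ {x} {xs : List ℕ} → x ∈ˡ xs → x ≤ foldr _⊔_ 0 xs
x≤foldr-⊔               (here refl) = m≤m⊔n _ _
x≤foldr-⊔ {xs = y ∷ _} (there x∈xs) = ≤-trans (x≤foldr-⊔ x∈xs) (m≤n⊔m y _)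

module _ {G : Graph} where

  private
    N : ℕ
    N = n G

  adj-sym : ∀ {u v} → Adj G u v → Adj G v u
  adj-sym {u} {v} = subst T (sym G u v)

  pathIn-source : ∀ {P u v} → PathIn G P u v → u ∈ P
  pathIn-source (here u∈P)     = u∈P
  pathIn-source (step u∈P _ _) = u∈P

  pathIn-target : ∀ {P u v} → PathIn G P u v → v ∈ P
  pathIn-target (here v∈P)   = v∈P
  pathIn-target (step _ _ p) = pathIn-target p

  pathIn-mono : ∀ {P Q u v} → P ⊆ Q → PathIn G P u v → PathIn G Q u v
  pathIn-mono P⊆Q (here u∈P)       = here (P⊆Q u∈P)
  pathIn-mono P⊆Q (step u∈P uw p) = step (P⊆Q u∈P) uw (pathIn-mono P⊆Q p)

  _++ᵖ_ : ∀ {P u v w} → PathIn G P u v → PathIn G P v w → PathIn G P u w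
  here _       ++ᵖ q = q
  step u∈P uw p ++ᵖ q = step u∈P uw (p ++ᵖ q)

  pathIn-reverse : ∀ {P u v} → PathIn G P u v → PathIn G P v u
  pathIn-reverse (here u∈P)       = here u∈P
  pathIn-reverse (step u∈P uw p) =
    pathIn-reverse p ++ᵖ step (pathIn-source p) (adj-sym uw) (here u∈P)

  exit-edge : ∀ {Q} (X : Subset N) {a c} → PathIn G Q a c → a ∈ X → c ∉ X →
              ∃₂ λ x y → x ∈ X × y ∉ X × Adj G x y
  exit-edge X (here _) a∈X c∉X = contradiction a∈X c∉X
  exit-edge X (step {w = w} _ aw p) a∈X c∉X with w ∈? X
  ... | yes w∈X = exit-edge X p w∈X c∉X
  ... | no  w∉X = _ , w , a∈X , w∉X , aw

  ClosedIn : Subset N → Subset N → Set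
  ClosedIn P C = ∀ u v → u ∈ C → v ∈ P → Adj G u v → v ∈ C

  pathIn-restrict : ∀ {P C u v} → ClosedIn P C → u ∈ C → PathIn G P u v → PathIn G C u v
  pathIn-restrict closed u∈C (here _)     = here u∈C
  pathIn-restrict closed u∈C (step _ uw p) =
    step u∈C uw (pathIn-restrict closed (closed _ _ u∈C (pathIn-source p) uw) p)

  isComponent-⊆ : ∀ {P C D x} → IsComponent G P C → IsComponent G P D →
                  x ∈ C → x ∈ D → C ⊆ D
  isComponent-⊆ (_ , C⊆P , C-connected , _) (_ , _ , _ , D-closed) x∈C x∈D {v} v∈C =
    pathIn-target (pathIn-restrict D-closed x∈D (pathIn-mono C⊆P (C-connected _ v x∈C v∈C)))

  module Saturation (P : Subset N) where

    Frontier : Subset N → Fin N → Set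
    Frontier X b = b ∉ X × b ∈ P × ∃ λ a → a ∈ X × Adj G a b

    frontier? : ∀ X → Decidable (Frontier X)
    frontier? X b = ¬? (b ∈? X) ×-dec b ∈? P ×-dec any? (λ a → a ∈? X ×-dec T? (adj G a b))

    saturate : ℕ → Subset N → Subset N
    saturate zero    X = X
    saturate (suc f) X with any? (frontier? X)
    ... | yes (b , _) = saturate f (X ∪ ⁅ b ⁆)
    ... | no  _       = X

    ReachIn : Fin N → Subset N → Set
    ReachIn u X = ∀ {v} → v ∈ X → PathIn G P v u

    saturate-⊇ : ∀ f X → X ⊆ saturate f X
    saturate-⊇ zero    X x∈X = x∈X
    saturate-⊇ (suc f) X x∈X with any? (frontier? X)
    ... | yes (b , _) = saturate-⊇ f (X ∪ ⁅ b ⁆) (p⊆p∪q ⁅ b ⁆ x∈X)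
    ... | no  _       = x∈X

    saturate-reachIn : ∀ {u} f X → ReachIn u X → ReachIn u (saturate f X)
    saturate-reachIn zero    X reach = reach
    saturate-reachIn {u} (suc f) X reach with any? (frontier? X)
    ... | yes (b , _ , b∈P , a , a∈X , ab) = saturate-reachIn f (X ∪ ⁅ b ⁆) reach′
      where
      reach′ : ReachIn u (X ∪ ⁅ b ⁆)
      reach′ v∈X∪b with x∈p∪q⁻ X ⁅ b ⁆ v∈X∪b
      ... | inj₁ v∈X = reach v∈X
      ... | inj₂ v∈b rewrite x∈⁅y⁆⇒x≡y b v∈b = step b∈P (adj-sym ab) (reach a∈X)
    ... | no  _ = reach

    -- Each round either stops at a closed set or adds a vertex, so N + 1 − ∣X∣ rounds suffice.
    saturate-closed : ∀ f X → N < ∣ X ∣ + f → ClosedIn P (saturate f X)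
    saturate-closed zero X N<∣X∣+0 =
      contradiction (∣p∣≤n X) (<⇒≱ (subst (N <_) (+-identityʳ ∣ X ∣) N<∣X∣+0))
    saturate-closed (suc f) X N<∣X∣+f+1 with any? (frontier? X)
    ... | yes (b , b∉X , _) = saturate-closed f (X ∪ ⁅ b ⁆)
      (≤-trans N<∣X∣+f+1 (≤-trans (≤-reflexive (+-suc ∣ X ∣ f)) (+-monoˡ-≤ f X⊂X∪b)))
      where
      X⊂X∪b : suc ∣ X ∣ ≤ ∣ X ∪ ⁅ b ⁆ ∣
      X⊂X∪b = p⊂q⇒∣p∣<∣q∣ (p⊆p∪q ⁅ b ⁆ , b , q⊆p∪q X ⁅ b ⁆ (x∈⁅x⁆ b) , b∉X)
    ... | no ¬frontier = closed
      where
      closed : ClosedIn P X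
      closed a b a∈X b∈P ab with b ∈? X
      ... | yes b∈X = b∈X
      ... | no  b∉X = contradiction (b , b∉X , b∈P , a , a∈X , ab) ¬frontier

  -- Empty outside P, so that components can be indexed by any vertex, e.g. by all of N(S) below.
  component : Subset N → Fin N → Subset N
  component P u with u ∈? P
  ... | yes _ = Saturation.saturate P N ⁅ u ⁆
  ... | no  _ = ⊥

  component-∉ : ∀ {P u} → u ∉ P → component P u ≡ ⊥
  component-∉ {P} {u} u∉P with u ∈? P
  ... | yes u∈P = contradiction u∈P u∉P
  ... | no  _   = refl

  component-isComponent : ∀ {P u} → u ∈ P → IsComponent G P (component P u) × u ∈ component P u
  component-isComponent {P} {u} u∈P with u ∈? P
  ... | no  u∉P = contradiction u∈P u∉P
  ... | yes _   = ((u , u∈C) , (λ v∈C → pathIn-source (reach v∈C)) , connected , closed) , u∈C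
    where
    open Saturation P

    C : Subset N
    C = saturate N ⁅ u ⁆

    u∈C : u ∈ C
    u∈C = saturate-⊇ N ⁅ u ⁆ (x∈⁅x⁆ u)

    reach₀ : ReachIn u ⁅ u ⁆
    reach₀ v∈⁅u⁆ rewrite x∈⁅y⁆⇒x≡y u v∈⁅u⁆ = here u∈P

    reach : ReachIn u C
    reach = saturate-reachIn N ⁅ u ⁆ reach₀

    closed : ClosedIn P C
    closed = saturate-closed N ⁅ u ⁆ (subst (λ s → N < s + N) (≡-sym (∣⁅x⁆∣≡1 u)) ≤-refl)

    connected : ∀ v w → v ∈ C → w ∈ C → PathIn G C v w
    connected v w v∈C w∈C =
      pathIn-restrict closed v∈C (reach v∈C) ++ᵖ pathIn-reverse (pathIn-restrict closed w∈C (reach w∈C))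

module _ {G : Graph} where

  private
    N : ℕ
    N = n G

  degree≤Δ : ∀ v → degree G v ≤ Δ G
  degree≤Δ v = x≤foldr-⊔ (∈-map⁺ (degree G) (∈-allFin v))

  neighbourhood : Subset N → Subset N
  neighbourhood S = ⋃[ s ∈ S ] tabulate (adj G s)

  ∣neighbourhood∣≤∣S∣*Δ : ∀ S → ∣ neighbourhood S ∣ ≤ ∣ S ∣ * Δ G
  ∣neighbourhood∣≤∣S∣*Δ S = ∣⋃∣≤∣I∣*c S (tabulate ∘ adj G) (Δ G) (λ {s} _ → degree≤Δ s)

  isComponent-∁-adjacent : ∀ {S D} → Connected G → Nonempty S → IsComponent G (∁ S) D →
                           ∃₂ λ x y → x ∈ D × y ∈ S × Adj G y x
  isComponent-∁-adjacent (_ , conn) (s , s∈S) ((v , v∈D) , D⊆∁S , _ , D-closed)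
    with exit-edge _ (conn v s) v∈D (x∈p⇒x∉∁p s∈S ∘ D⊆∁S)
  ... | x , y , x∈D , y∉D , xy =
    x , y , x∈D , x∉∁p⇒x∈p (λ y∈∁S → y∉D (D-closed x y x∈D y∈∁S xy)) , adj-sym {G = G} xy

  safeSet⇒∣component∣≤∣S∣ : ∀ {S D} → Connected G → SafeSet G S → IsComponent G (∁ S) D →
                            ∣ D ∣ ≤ ∣ S ∣
  safeSet⇒∣component∣≤∣S∣ conn (S≢∅ , safe) D-comp
    with isComponent-∁-adjacent conn S≢∅ D-comp
  ... | x , y , x∈D , y∈S , yx
    with component-isComponent y∈S
  ... | C-comp@(_ , C⊆S , _) , y∈C =
    ≤-trans (safe _ _ C-comp D-comp (y , x , y∈C , x∈D , yx)) (p⊆q⇒∣p∣≤∣q∣ C⊆S)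

  ∣component∁∣≤∣S∣ : ∀ {S} → Connected G → SafeSet G S → ∀ x → ∣ component (∁ S) x ∣ ≤ ∣ S ∣
  ∣component∁∣≤∣S∣ {S} conn safe x = by-cases (x ∈? ∁ S)
    where
    by-cases : Dec (x ∈ ∁ S) → ∣ component (∁ S) x ∣ ≤ ∣ S ∣
    by-cases (yes x∈∁S) = safeSet⇒∣component∣≤∣S∣ conn safe (proj₁ (component-isComponent x∈∁S))
    by-cases (no  x∉∁S) =
      subst (_≤ ∣ S ∣) (≡-sym (trans (cong ∣_∣ (component-∉ x∉∁S)) (∣⊥∣≡0 N))) z≤n

  ∁⊆⋃component : ∀ {S} → Connected G → Nonempty S →
                 ∁ S ⊆ ⋃[ x ∈ neighbourhood S ] component (∁ S) x
  ∁⊆⋃component {S} conn S≢∅ {v} v∈∁S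
    with component-isComponent v∈∁S
  ... | D-comp@(_ , D⊆∁S , _) , v∈D
    with isComponent-∁-adjacent conn S≢∅ D-comp
  ... | x , y , x∈D , y∈S , yx
    with component-isComponent (D⊆∁S x∈D)
  ... | Dx-comp , x∈Dx =
    x∈⋃⁺ (neighbourhood S) (component (∁ S))
      (x∈⋃⁺ S (tabulate ∘ adj G) y∈S (x∈tabulate⁺ yx))
      (isComponent-⊆ D-comp Dx-comp x∈D x∈Dx v∈D)

  safeSet-bound : ∀ {S} → Connected G → SafeSet G S → N ≤ ∣ S ∣ + ∣ S ∣ * ∣ S ∣ * Δ G
  safeSet-bound {S} conn safe@(S≢∅ , _) = begin
    N                                  ≡⟨ ≡-sym (∣p∣+∣∁p∣≡n S) ⟩
    ∣ S ∣ + ∣ ∁ S ∣                    ≤⟨ +-monoʳ-≤ ∣ S ∣ ∣∁S∣≤ ⟩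
    ∣ S ∣ + ∣ S ∣ * Δ G * ∣ S ∣        ≡⟨ cong (∣ S ∣ +_) (xy∙z≈xz∙y (∣ S ∣) (Δ G) (∣ S ∣)) ⟩
    ∣ S ∣ + ∣ S ∣ * ∣ S ∣ * Δ G        ∎
    where
    open ≤-Reasoning

    ∣∁S∣≤ : ∣ ∁ S ∣ ≤ ∣ S ∣ * Δ G * ∣ S ∣
    ∣∁S∣≤ = begin
      ∣ ∁ S ∣
        ≤⟨ p⊆q⇒∣p∣≤∣q∣ (∁⊆⋃component conn S≢∅) ⟩
      ∣ ⋃[ x ∈ neighbourhood S ] component (∁ S) x ∣
        ≤⟨ ∣⋃∣≤∣I∣*c (neighbourhood S) _ ∣ S ∣ (λ {x} _ → ∣component∁∣≤∣S∣ conn safe x) ⟩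
      ∣ neighbourhood S ∣ * ∣ S ∣
        ≤⟨ *-monoˡ-≤ ∣ S ∣ (∣neighbourhood∣≤∣S∣*Δ S) ⟩
      ∣ S ∣ * Δ G * ∣ S ∣
        ∎

mainTheorem15 : (G : Graph) → Connected G → (k : ℕ) → SafeNumber G k →
    n G ≤ k + k * k * Δ G
mainTheorem15 G conn _ (S , ((safe , _) , refl)) = safeSet-bound conn safe
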